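{- Let $G=(V,E)$ be a finite connected loopless graph and $\mathfrak{C}$ a generalized cut of $G$. The following are equivalent: (1) $\mathfrak{C}$ is a bond, i.e. $\kappa(\mathfrak{C})=1$; (2) $\mathfrak{C}$ is given by an ordered partition $V_1,V_2$ of $V$ such that the induced subgraphs $G[V_1]$ and $G[V_2]$ are both connected; (3) there is no non-empty cut $\mathbb{E}(C,V-C)$, $C\subseteq V$, properly contained in $\mathbb{E}(\mathfrak{C})$.
   Context: $\mathbb{E}(C_1,C_2)$ denotes the set of oriented edges with tail in $C_1$ and head in $C_2$; $G[C]$ is the subgraph induced on $C$. A generalized cut $\mathfrak{C}$ is an ordered partition $V_1,\dots,V_s$ ($s\ge2$) of $V$ with no edge between $V_i$ and $V_j$ when $|i-j|\ge2$; $\mathbb{E}(\mathfrak{C})$ is the set of oriented edges with tail in $V_i$ and head in $V_{i+1}$ for some $i$. For $i=1,\dots,s-1$ let $C_i=V_1\cup\dots\cup V_i$, $S_i=V_{i+1}\cup\dots\cup V_s$, let $l_i$ and $r_i$ be the numbers of connected components of $G[C_i]$ and $G[S_i]$; the rank is $\kappa(\mathfrak{C})=\sum_{i=1}^{s-1}(l_i+r_i-1)$. -}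

module Defs where

open import Data.Nat using (ℕ; zero; suc; _+_; _∸_; _≤_; _<_; pred)
open import Data.Fin using (Fin; toℕ)
open import Data.Bool using (Bool; true; false; T; not)
open import Data.Product using (Σ; ∃; _×_; _,_)
open import Data.List using (tabulate)
open import Data.Nat.ListAction using (sum)
open import Data.Unit using (⊤)
open import Relation.Binary.PropositionalEquality using (_≡_; _≢_)
open import Relation.Nullary using (¬_)
open import Function.Bundles using (_⇔_)

-- A finite loopless (multi)graph: vertices Fin n, edges Fin m,
-- each edge e has endpoints src e and tgt e (an arbitrary reference
-- orientation), distinct since there are no loops.
record Graph : Set where
  field
    n        : ℕ
    m        : ℕ
    src      : Fin m → Fin n
    tgt      : Fin m → Fin n
    loopless : ∀ e → src e ≢ tgt e
open Graph public

VSet : Graph → Set₁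
VSet G = Fin (n G) → Set

-- Oriented edges: an edge together with one of its two orientations.
OEdge : Graph → Set
OEdge G = Fin (m G) × Bool

tail head : (G : Graph) → OEdge G → Fin (n G)
tail G (e , true)  = src G e
tail G (e , false) = tgt G e
head G (e , true)  = tgt G e
head G (e , false) = src G e

-- Walks in the induced subgraph G[P]: all vertices lie in P.
data Walk (G : Graph) (P : VSet G) : Fin (n G) → Fin (n G) → Set where
  here : ∀ {v} → P v → Walk G P v v
  step : ∀ {w} (oe : OEdge G) → P (tail G oe) →
         Walk G P (head G oe) w → Walk G P (tail G oe) w

InducedConnected : (G : Graph) → VSet G → Set
InducedConnected G P = (∃ λ v → P v) × (∀ u v → P u → P v → Walk G P u v)

Connected : Graph → Set
Connected G = InducedConnected G (λ _ → ⊤)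

-- G[P] has exactly k connected components: a labelling of the
-- vertices of P by Fin k, onto, whose fibres are exactly the
-- connectivity classes of G[P].
ComponentCount : (G : Graph) → VSet G → ℕ → Set
ComponentCount G P k =
  Σ ((v : Fin (n G)) → P v → Fin k) λ f →
    (∀ j → ∃ λ v → Σ (P v) λ p → f v p ≡ j) ×
    (∀ u v (pu : P u) (pv : P v) → (f u pu ≡ f v pv) ⇔ Walk G P u v)

-- A generalized cut: ordered partition V_1,…,V_s (s ≥ 2) of V, given
-- by part : V → Fin s (V_{i+1} = part⁻¹(i), 0-based), all parts
-- non-empty, and no edge joins V_i and V_j with |i - j| ≥ 2.
record GenCut (G : Graph) : Set where
  field
    s         : ℕ
    two≤s     : 2 ≤ s
    part      : Fin (n G) → Fin s
    nonempty  : ∀ i → ∃ λ v → part v ≡ i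
    adjacent  : ∀ e → (toℕ (part (src G e)) ≤ suc (toℕ (part (tgt G e))))
                    × (toℕ (part (tgt G e)) ≤ suc (toℕ (part (src G e))))
open GenCut public

-- 𝔼(𝔈): oriented edges from V_i to V_{i+1}.
InCutEdges : {G : Graph} → GenCut G → OEdge G → Set
InCutEdges {G} 𝔈 oe = toℕ (part 𝔈 (head G oe)) ≡ suc (toℕ (part 𝔈 (tail G oe)))

-- For index i : Fin (s - 1) standing for the paper's i+1 ∈ {1,…,s-1}:
-- C = V_1 ∪ … ∪ V_{i+1},  S = V_{i+2} ∪ … ∪ V_s.
Cset Sset : {G : Graph} (𝔈 : GenCut G) → Fin (pred (s 𝔈)) → VSet G
Cset 𝔈 i v = toℕ (part 𝔈 v) ≤ toℕ i
Sset 𝔈 i v = toℕ i < toℕ (part 𝔈 v)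

-- κ(𝔈) = k, where κ(𝔈) = Σ_{i=1}^{s-1} (l_i + r_i - 1), l_i, r_i the
-- numbers of components of G[C_i], G[S_i].
HasRank : {G : Graph} → GenCut G → ℕ → Set
HasRank {G} 𝔈 k =
  Σ (Fin (pred (s 𝔈)) → ℕ) λ l → Σ (Fin (pred (s 𝔈)) → ℕ) λ r →
    (∀ i → ComponentCount G (Cset 𝔈 i) (l i)) ×
    (∀ i → ComponentCount G (Sset 𝔈 i) (r i)) ×
    (sum (tabulate (λ i → l i + r i ∸ 1)) ≡ k)

IsBond : {G : Graph} → GenCut G → Set
IsBond 𝔈 = HasRank 𝔈 1

TwoConnectedParts : {G : Graph} → GenCut G → Set
TwoConnectedParts {G} 𝔈 =
  (s 𝔈 ≡ 2) ×
  InducedConnected G (λ v → toℕ (part 𝔈 v) ≡ 0) ×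
  InducedConnected G (λ v → toℕ (part 𝔈 v) ≡ 1)

InSimpleCut : {G : Graph} → (Fin (n G) → Bool) → OEdge G → Set
InSimpleCut {G} C oe = T (C (tail G oe)) × T (not (C (head G oe)))

NoSmallerCut : {G : Graph} → GenCut G → Set
NoSmallerCut {G} 𝔈 =
  ¬ (Σ (Fin (n G) → Bool) λ C →
       (∃ λ oe → InSimpleCut {G} C oe) ×
       (∀ oe → InSimpleCut {G} C oe → InCutEdges 𝔈 oe) ×
       (∃ λ oe → InCutEdges 𝔈 oe × ¬ InSimpleCut {G} C oe))

module Submission where

-- With three or more parts, E(V₁, V − V₁) is a non-empty cut strictly inside E(𝔈): it misses
-- the edges from V₂ to V₃, which exist because G is connected. With two parts, E(𝔈) is the cut
-- E(V₁, V − V₁); if G[V₁] were disconnected, the component K of a vertex of V₁ in G[V₁] would give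
-- a non-empty cut E(K, V − K) that lies in E(𝔈) but misses the edges leaving V₁ from V₁ − K
-- (and V₂ is handled by passing to complements). Conversely, if G[V₁] and G[V₂] are connected,
-- a cut E(C, V − C) ⊆ E(𝔈) forces C to be constant on each part, so it is all of E(𝔈) or empty.
-- Finally κ(𝔈) is a sum of s − 1 terms l_i + r_i − 1 ≥ 1, so κ(𝔈) = 1 exactly when s = 2 and
-- both parts have one component.

open import Defs
open import Data.Bool using (Bool; true; false; T; not; _∧_)
open import Data.Bool.Properties using (T-∧)
open import Data.Empty using (⊥-elim)
open import Data.Fin using (Fin; toℕ; fromℕ<) renaming (zero to fzero; suc to fsuc)
open import Data.Fin.Properties using (any?; toℕ<n; toℕ-fromℕ<)
open import Data.Fin.Subset using (Subset; _∈_; _∪_; ⁅_⁆; _⊃_)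
open import Data.Fin.Subset.Induction using (⊃-wellFounded)
open import Data.Fin.Subset.Properties
  using (_∈?_; x∈⁅x⁆; x∈p∪q⁺; x∈p∪q⁻; p⊆p∪q; x∈⁅y⁆⇒x≡y)
open import Data.List using (tabulate)
open import Data.Nat using (ℕ; suc; _+_; _∸_; _≤_; _<_; _≤ᵇ_; pred; z≤n; s≤s)
open import Data.Nat.ListAction using (sum)
open import Data.Nat.Properties
  using ( ≤ᵇ⇒≤; ≤⇒≤ᵇ; +-mono-≤; m≤m+n; m≤n+m; <⇒≱; ≰⇒>; ≮⇒≥; ≤-antisym; ≤-trans; ≤-refl
        ; ≤-pred; n≤0⇒n≡0; n<1⇒n≡0; +-suc; +-identityʳ; suc-injective; 1+n≢n)
open import Data.Product using (Σ; ∃; _×_; _,_; proj₁; proj₂)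
open import Data.Sum using (inj₁; inj₂)
open import Data.Unit using (tt)
open import Function using (_∘_; id)
open import Function.Bundles using (_⇔_; mk⇔; Equivalence)
import Function.Properties.Equivalence as ⇔
open import Induction.WellFounded using (Acc; acc)
open import Relation.Nullary using (¬_; Dec; yes; no)
open import Relation.Nullary.Decidable
  using (isYes; toWitness; fromWitness; decidable-stable; map′; _⊎-dec_; _×-dec_; ¬?; T?)
open import Relation.Binary.PropositionalEquality

open Equivalence using (to; from)

T-not⇒¬T : ∀ {b} → T (not b) → ¬ T b
T-not⇒¬T {false} _ ()

¬T⇒T-not : ∀ {b} → ¬ T b → T (not b)
¬T⇒T-not {true}  ¬t = ¬t tt
¬T⇒T-not {false} _  = tt

T-not-not : ∀ {b} → T (not (not b)) ⇔ T b
T-not-not {true}  = mk⇔ id id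
T-not-not {false} = mk⇔ id id

T-not-∧-not : ∀ {a b} → T (not (a ∧ not b)) → T a → T b
T-not-∧-not {true} {true} _ _ = tt

+∸1-positive : ∀ {a b} → 1 ≤ a → 1 ≤ b → 1 ≤ a + b ∸ 1
+∸1-positive {suc a} {b} _ 1≤b = ≤-trans 1≤b (m≤n+m b a)

+∸1≡1 : ∀ {a b} → 1 ≤ a → 1 ≤ b → a + b ∸ 1 ≡ 1 → a ≡ 1 × b ≡ 1
+∸1≡1 {1}           {1}           _ _ _  = refl , refl
+∸1≡1 {1}           {suc (suc b)} _ _ ()
+∸1≡1 {suc (suc a)} {suc b}       _ _ eq with trans (sym (+-suc a b)) (suc-injective eq)
... | ()

sum-tabulate-positive≡1 : ∀ {k} (g : Fin k → ℕ) → (∀ i → 1 ≤ g i) → sum (tabulate g) ≡ 1 →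
                          k ≡ 1 × (∀ i → g i ≡ 1)
sum-tabulate-positive≡1 {0} g _ ()
sum-tabulate-positive≡1 {1} g _ eq = refl , λ { fzero → trans (sym (+-identityʳ (g fzero))) eq }
sum-tabulate-positive≡1 {suc (suc k)} g positive eq =
  ⊥-elim (<⇒≱ (s≤s (s≤s z≤n)) (subst (2 ≤_) eq two≤sum))
  where
    two≤sum : 2 ≤ sum (tabulate g)
    two≤sum = +-mono-≤ (positive fzero) (≤-trans (positive (fsuc fzero)) (m≤m+n _ _))

pred[n]<n : ∀ {k} → 1 ≤ k → pred k < k
pred[n]<n (s≤s _) = ≤-refl

pred[n]≡1⇒n≡2 : ∀ {k} → 2 ≤ k → pred k ≡ 1 → k ≡ 2
pred[n]≡1⇒n≡2 (s≤s (s≤s z≤n)) refl = refl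

Fin1-unique : (i j : Fin 1) → i ≡ j
Fin1-unique fzero fzero = refl

module _ {G : Graph} where

  connected-walk : Connected G → ∀ u v → Walk G _ u v
  connected-walk conn u v = proj₂ conn u v tt tt

  walk-source : ∀ {P u v} → Walk G P u v → P u
  walk-source (here p)     = p
  walk-source (step _ p _) = p

  walk-target : ∀ {P u v} → Walk G P u v → P v
  walk-target (here p)     = p
  walk-target (step _ _ w) = walk-target w

  walk-map : ∀ {P Q : VSet G} → (∀ {v} → P v → Q v) → ∀ {u v} → Walk G P u v → Walk G Q u v
  walk-map f (here p)      = here (f p)
  walk-map f (step oe p w) = step oe (f p) (walk-map f w)

  walk-snoc : ∀ {P u} oe → Walk G P u (tail G oe) → P (head G oe) → Walk G P u (head G oe)
  walk-snoc oe (here p)       q = step oe p (here q)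
  walk-snoc oe (step oe′ p w) q = step oe′ p (walk-snoc oe w q)

  walk-preserves : ∀ {P Q : VSet G} →
                   (∀ oe → P (tail G oe) → P (head G oe) → Q (tail G oe) → Q (head G oe)) →
                   ∀ {u v} → Walk G P u v → Q u → Q v
  walk-preserves step-preserves (here _)      q = q
  walk-preserves step-preserves (step oe p w) q =
    walk-preserves step-preserves w (step-preserves oe p (walk-source w) q)

  walk-crosses-cut : ∀ {P u v} (C : Fin (n G) → Bool) → Walk G P u v →
                     T (C u) → T (not (C v)) → ∃ (InSimpleCut {G} C)
  walk-crosses-cut C (here _) u∈C v∉C = ⊥-elim (T-not⇒¬T v∉C u∈C)
  walk-crosses-cut C (step oe _ w) t∈C v∉C with T? (C (head G oe))
  ... | yes h∈C = walk-crosses-cut C w h∈C v∉C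
  ... | no  h∉C = oe , t∈C , ¬T⇒T-not h∉C

  InducedConnected-cong : ∀ {P Q : VSet G} → (∀ v → P v ⇔ Q v) →
                          InducedConnected G P ⇔ InducedConnected G Q
  InducedConnected-cong P⇔Q = mk⇔ (transport P⇔Q) (transport (⇔.sym ∘ P⇔Q))
    where
      transport : ∀ {P Q : VSet G} → (∀ v → P v ⇔ Q v) → InducedConnected G P → InducedConnected G Q
      transport P⇔Q ((u , pu) , walks) =
        (u , to (P⇔Q u) pu) ,
        λ x y qx qy → walk-map (to (P⇔Q _)) (walks x y (from (P⇔Q x) qx) (from (P⇔Q y) qy))

  componentCount-positive : ∀ {P : VSet G} {k} → ComponentCount G P k → ∃ P → 1 ≤ k
  componentCount-positive (label , _) (v , pv) = ≤-trans (s≤s z≤n) (toℕ<n (label v pv))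

  componentCount1⇔connected : ∀ {P : VSet G} → ComponentCount G P 1 ⇔ InducedConnected G P
  componentCount1⇔connected = mk⇔
    (λ (label , onto , same⇔walk) →
       (let v , pv , _ = onto fzero in v , pv) ,
       λ u v pu pv → to (same⇔walk u v pu pv) (Fin1-unique _ _))
    (λ ((v , pv) , walks) →
       (λ _ _ → fzero) , (λ { fzero → v , pv , refl }) ,
       λ x y px py → mk⇔ (λ _ → walks x y px py) (λ _ → refl))

  reverse : OEdge G → OEdge G
  reverse (e , b) = e , not b

  tail-reverse : ∀ oe → tail G (reverse oe) ≡ head G oe
  tail-reverse (e , true)  = refl
  tail-reverse (e , false) = refl

  head-reverse : ∀ oe → head G (reverse oe) ≡ tail G oe
  head-reverse (e , true)  = refl
  head-reverse (e , false) = refl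

  InSimpleCut-reverse : ∀ (C : Fin (n G) → Bool) oe →
                        InSimpleCut {G} C oe ⇔ InSimpleCut {G} (not ∘ C) (reverse oe)
  InSimpleCut-reverse C oe rewrite tail-reverse oe | head-reverse oe =
    mk⇔ (λ (t∈C , h∉C) → h∉C , from T-not-not t∈C) (λ (h∉C , t∈C) → to T-not-not t∈C , h∉C)

  InSimpleCut-complement : ∀ (C : Fin (n G) → Bool) oe →
                           InSimpleCut {G} (not ∘ C) oe ⇔ InSimpleCut {G} C (reverse oe)
  InSimpleCut-complement C oe rewrite tail-reverse oe | head-reverse oe =
    mk⇔ (λ (t∉C , h∈C) → to T-not-not h∈C , t∉C) (λ (h∈C , t∉C) → t∉C , from T-not-not h∈C)

  -- NoSmallerCut 𝔈 unfolds to ¬ SmallerCut (InCutEdges 𝔈).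
  SmallerCut : (OEdge G → Set) → Set
  SmallerCut D =
    Σ (Fin (n G) → Bool) λ C →
      (∃ λ oe → InSimpleCut {G} C oe) ×
      (∀ oe → InSimpleCut {G} C oe → D oe) ×
      (∃ λ oe → D oe × ¬ InSimpleCut {G} C oe)

  SmallerCut-resp : ∀ {D D′ : OEdge G → Set} → (∀ oe → D oe ⇔ D′ oe) →
                    SmallerCut D → SmallerCut D′
  SmallerCut-resp D⇔D′ (C , nonempty , C⊆D , (oe , oe∈D , oe∉C)) =
    C , nonempty , (λ oe → to (D⇔D′ oe) ∘ C⊆D oe) , (oe , to (D⇔D′ oe) oe∈D , oe∉C)

  SmallerCut-complement : ∀ (A : Fin (n G) → Bool) →
                          SmallerCut (InSimpleCut {G} (not ∘ A)) → SmallerCut (InSimpleCut {G} A)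
  SmallerCut-complement A (C , (oe₀ , oe₀∈C) , C⊆A , (oe₁ , oe₁∈A , oe₁∉C)) =
    not ∘ C ,
    (reverse oe₀ , to (InSimpleCut-reverse C oe₀) oe₀∈C) ,
    (λ oe → from (InSimpleCut-reverse A oe) ∘ C⊆A (reverse oe) ∘ to (InSimpleCut-complement C oe)) ,
    (reverse oe₁ , to (InSimpleCut-complement A oe₁) oe₁∈A ,
     oe₁∉C ∘ from (InSimpleCut-reverse C oe₁))

record Component (G : Graph) (P : VSet G) (u : Fin (n G)) : Set where
  field
    member    : Fin (n G) → Bool
    root      : T (member u)
    reachable : ∀ {v} → T (member v) → Walk G P u v
    closed    : ∀ oe → T (member (tail G oe)) → P (head G oe) → T (member (head G oe))

  closed-reverse : ∀ oe → T (member (head G oe)) → P (tail G oe) → T (member (tail G oe))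
  closed-reverse oe with closed (reverse {G} oe)
  ... | closed′ rewrite tail-reverse {G} oe | head-reverse {G} oe = closed′

module _ {G : Graph} where

  any-OEdge? : ∀ {Q : OEdge G → Set} → (∀ oe → Dec (Q oe)) → Dec (∃ Q)
  any-OEdge? Q? =
    map′ (λ { (e , inj₁ q) → (e , true) , q ; (e , inj₂ q) → (e , false) , q })
         (λ { ((e , true) , q) → e , inj₁ q ; ((e , false) , q) → e , inj₂ q })
         (any? λ e → Q? (e , true) ⊎-dec Q? (e , false))

  module _ {P : VSet G} (P? : ∀ v → Dec (P v)) {u : Fin (n G)} where

    private
      explore : (S : Subset (n G)) → Acc _⊃_ S → u ∈ S → (∀ {v} → v ∈ S → Walk G P u v) →
                Component G P u
      explore S (acc larger) u∈S reach
        with any-OEdge? (λ oe → (tail G oe ∈? S) ×-dec P? (head G oe) ×-dec ¬? (head G oe ∈? S))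
      ... | yes (oe , t∈S , Ph , h∉S) =
        explore (S ∪ ⁅ head G oe ⁆) (larger (p⊆p∪q _ , head G oe , x∈p∪q⁺ (inj₂ (x∈⁅x⁆ _)) , h∉S))
                (p⊆p∪q _ u∈S) reach′
        where
          reach′ : ∀ {v} → v ∈ S ∪ ⁅ head G oe ⁆ → Walk G P u v
          reach′ v∈ with x∈p∪q⁻ S _ v∈
          ... | inj₁ v∈S = reach v∈S
          ... | inj₂ v∈h rewrite x∈⁅y⁆⇒x≡y _ v∈h = walk-snoc oe (reach t∈S) Ph
      ... | no no-edge-leaves = record
        { member    = λ v → isYes (v ∈? S)
        ; root      = fromWitness u∈S
        ; reachable = reach ∘ toWitness
        ; closed    = λ oe t∈S Ph → fromWitness (decidable-stable (_ ∈? S)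
                        λ h∉S → no-edge-leaves (oe , toWitness t∈S , Ph , h∉S))
        }

    component : P u → Component G P u
    component Pu = explore ⁅ u ⁆ (⊃-wellFounded _) (x∈⁅x⁆ u)
                     (λ v∈u → subst (Walk G P u) (sym (x∈⁅y⁆⇒x≡y _ v∈u)) (here Pu))

module _ {G : Graph} (conn : Connected G) where

  proper-component⇒SmallerCut : ∀ (A : Fin (n G) → Bool) {u v w} (K : Component G (T ∘ A) u) →
                                T (A v) → ¬ T (Component.member K v) → T (not (A w)) →
                                SmallerCut (InSimpleCut {G} A)
  proper-component⇒SmallerCut A {u} {v} {w} K v∈A v∉K w∉A =
    member ,
    walk-crosses-cut member (connected-walk conn u v) root (¬T⇒T-not v∉K) ,
    K-cut⊆A-cut ,
    A-cut∖K-cut (walk-crosses-cut A∖K (connected-walk conn v w)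
                   (from T-∧ (v∈A , ¬T⇒T-not v∉K)) (¬T⇒T-not (T-not⇒¬T w∉A ∘ proj₁ ∘ to T-∧)))
    where
      open Component K

      K-cut⊆A-cut : ∀ oe → InSimpleCut {G} member oe → InSimpleCut {G} A oe
      K-cut⊆A-cut oe (t∈K , h∉K) =
        walk-target (reachable t∈K) , ¬T⇒T-not (T-not⇒¬T h∉K ∘ closed oe t∈K)

      A∖K : Fin (n G) → Bool
      A∖K x = A x ∧ not (member x)

      A-cut∖K-cut : ∃ (InSimpleCut {G} A∖K) →
                    ∃ λ oe → InSimpleCut {G} A oe × ¬ InSimpleCut {G} member oe
      A-cut∖K-cut (oe , t∈A∖K , h∉A∖K) =
        let t∈A , t∉K = to T-∧ t∈A∖K
            h∉A = ¬T⇒T-not λ h∈A →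
                    T-not⇒¬T t∉K (closed-reverse oe (T-not-∧-not {A (head G oe)} h∉A∖K h∈A) t∈A)
        in oe , (t∈A , h∉A) , λ (t∈K , _) → T-not⇒¬T t∉K t∈K

  ¬SmallerCut⇒connected : ∀ (A : Fin (n G) → Bool) → (∃ λ u → T (A u)) → (∃ λ w → T (not (A w))) →
                          ¬ SmallerCut (InSimpleCut {G} A) → InducedConnected G (T ∘ A)
  ¬SmallerCut⇒connected A (u , u∈A) (w , w∉A) noSmaller = (u , u∈A) , walk-within
    where
      walk-within : ∀ x y → T (A x) → T (A y) → Walk G (T ∘ A) x y
      walk-within x y x∈A y∈A with component (T? ∘ A) x∈A
      ... | K with T? (Component.member K y)
      ... | yes y∈K = Component.reachable K y∈K
      ... | no  y∉K = ⊥-elim (noSmaller (proper-component⇒SmallerCut A K y∈A y∉K w∉A))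

module _ {G : Graph} (𝔈 : GenCut G) where

  -- Levels are 0-based: level v ≡ k means v ∈ V_{k+1}, and Below k is C_{k+1} = V₁ ∪ … ∪ V_{k+1}.
  level : Fin (n G) → ℕ
  level v = toℕ (part 𝔈 v)

  Below : ℕ → Fin (n G) → Bool
  Below k v = level v ≤ᵇ k

  vertex-at-level : ∀ {k} → k < s 𝔈 → ∃ λ v → level v ≡ k
  vertex-at-level k<s =
    let v , v∈Vₖ = nonempty 𝔈 (fromℕ< k<s) in v , trans (cong toℕ v∈Vₖ) (toℕ-fromℕ< k<s)

  level-head≤ : ∀ oe → level (head G oe) ≤ suc (level (tail G oe))
  level-head≤ (e , true)  = proj₂ (adjacent 𝔈 e)
  level-head≤ (e , false) = proj₁ (adjacent 𝔈 e)

  below⁺ : ∀ {k v} → level v ≤ k → T (Below k v)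
  below⁺ = ≤⇒≤ᵇ

  below⁻ : ∀ {k v} → T (Below k v) → level v ≤ k
  below⁻ = ≤ᵇ⇒≤ _ _

  above⁺ : ∀ {k v} → k < level v → T (not (Below k v))
  above⁺ k<l = ¬T⇒T-not (<⇒≱ k<l ∘ below⁻)

  above⁻ : ∀ {k v} → T (not (Below k v)) → k < level v
  above⁻ v∉ = ≰⇒> (T-not⇒¬T v∉ ∘ below⁺)

  below₀⇔level₀ : ∀ v → T (Below 0 v) ⇔ level v ≡ 0
  below₀⇔level₀ v = mk⇔ (n≤0⇒n≡0 ∘ below⁻) (λ l≡0 → below⁺ (subst (_≤ 0) (sym l≡0) z≤n))

  lowerCut-levels : ∀ k oe → InSimpleCut {G} (Below k) oe →
                    level (tail G oe) ≡ k × InCutEdges 𝔈 oe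
  lowerCut-levels k oe (t∈ , h∉) =
    ≤-antisym t≤k (≤-pred (≤-trans k<h h≤t+1)) , ≤-antisym h≤t+1 (≤-trans (s≤s t≤k) k<h)
    where
      t≤k = below⁻ t∈
      k<h = above⁻ h∉
      h≤t+1 = level-head≤ oe

  lowerCut-nonempty : Connected G → ∀ {k} → suc k < s 𝔈 → ∃ (InSimpleCut {G} (Below k))
  lowerCut-nonempty conn {k} k+1<s =
    let u , u₀ = vertex-at-level (≤-trans (s≤s z≤n) k+1<s)
        v , v₁ = vertex-at-level k+1<s
    in walk-crosses-cut (Below k) (connected-walk conn u v)
         (below⁺ (subst (_≤ k) (sym u₀) z≤n)) (above⁺ (subst (k <_) (sym v₁) ≤-refl))

  three-parts⇒SmallerCut : Connected G → 2 < s 𝔈 → SmallerCut (InCutEdges 𝔈)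
  three-parts⇒SmallerCut conn 2<s =
    Below 0 ,
    lowerCut-nonempty conn (≤-trans (s≤s (s≤s z≤n)) 2<s) ,
    (λ oe → proj₂ ∘ lowerCut-levels 0 oe) ,
    (let oe , oe∈ = lowerCut-nonempty conn 2<s
         t₁ , oe∈𝔈 = lowerCut-levels 1 oe oe∈
     in oe , oe∈𝔈 , λ (t∈ , _) → <⇒≱ (subst (0 <_) (sym t₁) (s≤s z≤n)) (below⁻ t∈))

  module _ (s≡2 : s 𝔈 ≡ 2) where

    level≤1 : ∀ v → level v ≤ 1
    level≤1 v = ≤-pred (subst (level v <_) s≡2 (toℕ<n (part 𝔈 v)))

    cutEdge-levels : ∀ oe → InCutEdges 𝔈 oe → level (tail G oe) ≡ 0 × level (head G oe) ≡ 1
    cutEdge-levels oe h≡t+1 = t≡0 , trans h≡t+1 (cong suc t≡0)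
      where t≡0 = n≤0⇒n≡0 (≤-pred (subst (_≤ 1) h≡t+1 (level≤1 (head G oe))))

    above₀⇔level₁ : ∀ v → T (not (Below 0 v)) ⇔ level v ≡ 1
    above₀⇔level₁ v = mk⇔ (λ v∉ → ≤-antisym (level≤1 v) (above⁻ v∉))
                          (λ l≡1 → above⁺ (subst (0 <_) (sym l≡1) (s≤s z≤n)))

    lowerCut₀⇔cutEdges : ∀ oe → InSimpleCut {G} (Below 0) oe ⇔ InCutEdges 𝔈 oe
    lowerCut₀⇔cutEdges oe = mk⇔ (proj₂ ∘ lowerCut-levels 0 oe) λ oe∈ →
      let t₀ , h₁ = cutEdge-levels oe oe∈
      in from (below₀⇔level₀ (tail G oe)) t₀ , from (above₀⇔level₁ (head G oe)) h₁

    index≡0 : (i : Fin (pred (s 𝔈))) → toℕ i ≡ 0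
    index≡0 i = n<1⇒n≡0 (subst (toℕ i <_) (cong pred s≡2) (toℕ<n i))

    Cset-count⇔V₁-connected : ∀ i → ComponentCount G (Cset 𝔈 i) 1 ⇔
                                    InducedConnected G (λ v → level v ≡ 0)
    Cset-count⇔V₁-connected i = ⇔.trans componentCount1⇔connected (InducedConnected-cong Cset⇔V₁)
      where
        Cset⇔V₁ : ∀ v → Cset 𝔈 i v ⇔ level v ≡ 0
        Cset⇔V₁ v rewrite index≡0 i = mk⇔ n≤0⇒n≡0 (λ l≡0 → subst (_≤ 0) (sym l≡0) z≤n)

    Sset-count⇔V₂-connected : ∀ i → ComponentCount G (Sset 𝔈 i) 1 ⇔
                                    InducedConnected G (λ v → level v ≡ 1)
    Sset-count⇔V₂-connected i = ⇔.trans componentCount1⇔connected (InducedConnected-cong Sset⇔V₂)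
      where
        Sset⇔V₂ : ∀ v → Sset 𝔈 i v ⇔ level v ≡ 1
        Sset⇔V₂ v rewrite index≡0 i =
          mk⇔ (≤-antisym (level≤1 v)) (λ l≡1 → subst (0 <_) (sym l≡1) (s≤s z≤n))

  bond⇒twoConnectedParts : IsBond 𝔈 → TwoConnectedParts 𝔈
  bond⇒twoConnectedParts (l , r , l-count , r-count , rank≡1) =
    s≡2 ,
    to (Cset-count⇔V₁-connected s≡2 i₀) (subst (ComponentCount G _) (proj₁ ones) (l-count i₀)) ,
    to (Sset-count⇔V₂-connected s≡2 i₀) (subst (ComponentCount G _) (proj₂ ones) (r-count i₀))
    where
      first = vertex-at-level {0} (≤-trans (s≤s z≤n) (two≤s 𝔈))
      last  = vertex-at-level (pred[n]<n (≤-trans (s≤s z≤n) (two≤s 𝔈)))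
      l-positive : ∀ i → 1 ≤ l i
      l-positive i = componentCount-positive (l-count i)
                       (proj₁ first , subst (_≤ toℕ i) (sym (proj₂ first)) z≤n)
      r-positive : ∀ i → 1 ≤ r i
      r-positive i = componentCount-positive (r-count i)
                       (proj₁ last , subst (toℕ i <_) (sym (proj₂ last)) (toℕ<n i))
      terms = sum-tabulate-positive≡1 _ (λ i → +∸1-positive (l-positive i) (r-positive i)) rank≡1
      s≡2 = pred[n]≡1⇒n≡2 (two≤s 𝔈) (proj₁ terms)
      i₀ : Fin (pred (s 𝔈))
      i₀ = fromℕ< (subst (0 <_) (sym (proj₁ terms)) (s≤s z≤n))
      ones = +∸1≡1 (l-positive i₀) (r-positive i₀) (proj₂ terms i₀)

  twoConnectedParts⇒bond : TwoConnectedParts 𝔈 → IsBond 𝔈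
  twoConnectedParts⇒bond (s≡2 , V₁-connected , V₂-connected) =
    (λ _ → 1) , (λ _ → 1) ,
    (λ i → from (Cset-count⇔V₁-connected s≡2 i) V₁-connected) ,
    (λ i → from (Sset-count⇔V₂-connected s≡2 i) V₂-connected) ,
    subst (λ k → sum (tabulate {n = k} λ _ → 1) ≡ 1) (sym (cong pred s≡2)) refl

  twoConnectedParts⇒noSmallerCut : TwoConnectedParts 𝔈 → NoSmallerCut 𝔈
  twoConnectedParts⇒noSmallerCut (s≡2 , (_ , walk₀) , (_ , walk₁))
                                 (C , (oe₀ , t₀∈C , h₀∉C) , C⊆𝔈 , (oe₁ , oe₁∈𝔈 , oe₁∉C)) =
    oe₁∉C (t₁∈C , h₁∉C)
    where
      level-constant-keeps-C : ∀ c oe → level (tail G oe) ≡ c → level (head G oe) ≡ c →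
                               T (C (tail G oe)) → T (C (head G oe))
      level-constant-keeps-C c oe t≡c h≡c t∈C = decidable-stable (T? _) λ h∉C →
        1+n≢n (trans (sym (C⊆𝔈 oe (t∈C , ¬T⇒T-not h∉C))) (trans h≡c (sym t≡c)))
      ends₀ = cutEdge-levels s≡2 oe₀ (C⊆𝔈 oe₀ (t₀∈C , h₀∉C))
      ends₁ = cutEdge-levels s≡2 oe₁ oe₁∈𝔈
      t₁∈C = walk-preserves {Q = T ∘ C} (level-constant-keeps-C 0)
               (walk₀ _ _ (proj₁ ends₀) (proj₁ ends₁)) t₀∈C
      h₁∉C = ¬T⇒T-not λ h₁∈C → T-not⇒¬T h₀∉C
               (walk-preserves {Q = T ∘ C} (level-constant-keeps-C 1)
                  (walk₁ _ _ (proj₂ ends₁) (proj₂ ends₀)) h₁∈C)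

  noSmallerCut⇒twoConnectedParts : Connected G → NoSmallerCut 𝔈 → TwoConnectedParts 𝔈
  noSmallerCut⇒twoConnectedParts conn noSmaller =
    s≡2 ,
    to (InducedConnected-cong below₀⇔level₀)
      (¬SmallerCut⇒connected conn (Below 0) V₁-vertex V₂-vertex noSmaller₀) ,
    to (InducedConnected-cong (above₀⇔level₁ s≡2))
      (¬SmallerCut⇒connected conn (not ∘ Below 0) V₂-vertex
        (proj₁ V₁-vertex , from T-not-not (proj₂ V₁-vertex))
        (noSmaller₀ ∘ SmallerCut-complement (Below 0)))
    where
      s≡2 : s 𝔈 ≡ 2
      s≡2 = ≤-antisym (≮⇒≥ (noSmaller ∘ three-parts⇒SmallerCut conn)) (two≤s 𝔈)
      noSmaller₀ : ¬ SmallerCut (InSimpleCut {G} (Below 0))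
      noSmaller₀ = noSmaller ∘ SmallerCut-resp (lowerCut₀⇔cutEdges s≡2)
      V₁-vertex : ∃ λ v → T (Below 0 v)
      V₁-vertex = let v , v₀ = vertex-at-level (≤-trans (s≤s z≤n) (two≤s 𝔈))
                  in v , from (below₀⇔level₀ v) v₀
      V₂-vertex : ∃ λ v → T (not (Below 0 v))
      V₂-vertex = let v , v₁ = vertex-at-level (two≤s 𝔈) in v , from (above₀⇔level₁ s≡2 v) v₁

proposition3p30 : (G : Graph) → Connected G → (𝔈 : GenCut G) →
                  (IsBond 𝔈 ⇔ TwoConnectedParts 𝔈) × (TwoConnectedParts 𝔈 ⇔ NoSmallerCut 𝔈)
proposition3p30 G conn 𝔈 =
  mk⇔ (bond⇒twoConnectedParts 𝔈) (twoConnectedParts⇒bond 𝔈) ,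
  mk⇔ (twoConnectedParts⇒noSmallerCut 𝔈) (noSmallerCut⇒twoConnectedParts 𝔈 conn)
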